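{- One has $\Phi_{x \to p,q} \circ \Phi_{p,q \to x} = \mathrm{Id}_{\mathrm{Sol}'}$. Moreover, $\Phi_{x \to p,q}$ has the same kernel as $\mathrm{ActY}$, that is the ideal $\langle M_1(\mathbb{X}) \rangle$ generated by $M_1(\mathbb{X})=\sum_i (-1)^{i+1} x_i$.
   Context: Stable polynomials: an element $f=(f_n)_{n\ge0}$ of $\mathbb{C}[X]$ is a sequence of polynomials $f_n(x_1,\dots,x_n)$ with $f_{n+1}(x_1,\dots,x_n,0)=f_n(x_1,\dots,x_n)$; similarly an element $h=(h_m)_{m\ge0}$ of $\mathbb{C}[\bm p,\bm q]$ is a sequence of polynomials $h_m$ in $p_1,\dots,p_m,q_1,\dots,q_m$ with $h_{m+1}$ evaluated at $p_{m+1}=q_{m+1}=0$ equal to $h_m$. $\mathrm{Sol}$ is the space of stable polynomials $f$ in commuting variables $x_1,x_2,\dots$ such that for all $n\ge2$ and $1\le i<n$, $f_n(x_1,\dots,x_n)|_{x_{i+1}=x_i}=f_{n-2}(x_1,\dots,x_{i-1},x_{i+2},\dots,x_n)$; equivalently $\mathrm{Sol}$ is the set of quasi-symmetric functions evaluated on the virtual alphabet $\mathbb{X}=\ominus(x_1)\oplus(x_2)\ominus(x_3)\oplus\cdots$, and $M_1(\mathbb{X})=\sum_i(-1)^{i+1}x_i$. $\mathrm{Sol}'$ is the space of $h\in\mathbb{C}[\bm p,\bm q]$ such that for all $1\le i\le m$: $h_m|_{q_i=0}=h_{m-1}(p_1,\dots,p_{i-1},p_i+p_{i+1},p_{i+2},\dots,p_m;\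 q_1,\dots,q_{i-1},q_{i+1},\dots,q_m)$ and $h_m|_{p_i=0}=h_{m-1}(p_1,\dots,p_{i-1},p_{i+1},\dots,p_m;\ q_1,\dots,q_{i-2},q_{i-1}+q_i,q_{i+1},\dots,q_m)$ (for $i=1$ or $i=m$ the undefined entries are dropped). The maps: for $f\in\mathrm{Sol}$, $\Phi_{x\to p,q}(f)=(h_m)$ with $h_m(p_1,\dots,p_m;q_1,\dots,q_m)=f_{2m+1}(x_1,\dots,x_{2m+1})$ where $x_{2i+1}=(q_{i+1}+\dots+q_m)-(p_1+\dots+p_i)$ and $x_{2i}=(q_i+\dots+q_m)-(p_1+\dots+p_i)$; this lands in $\mathrm{Sol}'$. Conversely, for $h\in\mathrm{Sol}'$, $\Phi_{p,q\to x}(h)\in\mathrm{Sol}$ is defined by $\Phi_{p,q\to x}(h)_{2m+1}(x_1,\dots,x_{2m+1})=h_m(p_1,\dots,p_m;q_1,\dots,q_m)$ with $p_i=x_{2i-1}-x_{2i}$, $q_i=x_{2i}-x_{2i+1}$. $\mathrm{ActY}:\mathrm{Sol}\to\mathcal{F}(\mathbb{Y},\mathbb{C})$ (functions on the set of Young diagrams) sends $f$ to $f\circ \mathrm{IC}$, where $\mathrm{IC}(\lambda)=(x_1,\dots,x_{2m+1})$ are the interlacing (Kerov) coordinates of $\lambda$: the abscissas, in decreasing order, of the local minima and maxima of the border of $\lambda$ drawn in Russian convention. It is known that the kernel of $\mathrm{ActY}$ is $\langle M_1(\mathbb{X})\rangle$. -}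

module Defs where

open import Level using (Level; _⊔_) renaming (suc to lsuc)
open import Data.Nat using (ℕ; zero; suc; _*_; _<ᵇ_; _/_)
open import Data.Fin using (Fin; toℕ) renaming (zero to fz; suc to fs)
open import Data.Sum using (_⊎_; inj₁; inj₂; [_,_])
open import Data.Product using (Σ; _×_; _,_)
open import Data.Bool using (if_then_else_)
open import Data.Vec.Functional using (Vector; []; _∷_; head; tail; insertAt)
open import Relation.Nullary using (¬_)
open import Algebra.Bundles using (CommutativeRing)

ringFromℕ : {c ℓ : Level} (R : CommutativeRing c ℓ) → ℕ → CommutativeRing.Carrier R
ringFromℕ R zero    = CommutativeRing.0# R
ringFromℕ R (suc n) = CommutativeRing._+_ R (CommutativeRing.1# R) (ringFromℕ R n)

record CharZeroField (c ℓ : Level) : Set (lsuc (c ⊔ ℓ)) where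
  field
    cring : CommutativeRing c ℓ
  open CommutativeRing cring public
    renaming (_+_ to _+K_; _*_ to _*K_; -_ to -K_)
  field
    1≉0      : ¬ (1# ≈ 0#)
    inverse  : ∀ x → ¬ (x ≈ 0#) → Σ Carrier (λ y → x *K y ≈ 1#)
    charZero : ∀ n → ¬ (ringFromℕ cring (suc n) ≈ 0#)

module _ {c ℓ : Level} (F : CharZeroField c ℓ) where
  open CharZeroField F

  -- Polynomials with coefficients in F over a set of variables V
  -- (syntax); two polynomials are identified when they agree as
  -- functions (equivalent to formal equality since F is infinite).

  data Poly (V : Set) : Set c where
    con  : Carrier → Poly V
    var  : V → Poly V
    _⊕_  : Poly V → Poly V → Poly V
    _⊗_  : Poly V → Poly V → Poly V
    ⊝_   : Poly V → Poly V

  ⟦_⟧ : {V : Set} → Poly V → (V → Carrier) → Carrier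
  ⟦ con a ⟧ ρ = a
  ⟦ var v ⟧ ρ = ρ v
  ⟦ p ⊕ q ⟧ ρ = ⟦ p ⟧ ρ +K ⟦ q ⟧ ρ
  ⟦ p ⊗ q ⟧ ρ = ⟦ p ⟧ ρ *K ⟦ q ⟧ ρ
  ⟦ ⊝ p ⟧ ρ = -K (⟦ p ⟧ ρ)

  _≐_ : {V : Set} → Poly V → Poly V → Set (c ⊔ ℓ)
  p ≐ q = ∀ ρ → ⟦ p ⟧ ρ ≈ ⟦ q ⟧ ρ

  _⊖_ : {V : Set} → Poly V → Poly V → Poly V
  p ⊖ q = p ⊕ (⊝ q)

  subst : {V W : Set} → Poly V → (V → Poly W) → Poly W
  subst (con a) σ = con a
  subst (var v) σ = σ v
  subst (p ⊕ q) σ = subst p σ ⊕ subst q σ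
  subst (p ⊗ q) σ = subst p σ ⊗ subst q σ
  subst (⊝ p) σ = ⊝ subst p σ

  ΣF : {V : Set} {m : ℕ} → (Fin m → Poly V) → Poly V
  ΣF {m = zero}  v = con 0#
  ΣF {m = suc m} v = head v ⊕ ΣF (tail v)

  altΣ : {V : Set} {m : ℕ} → (Fin m → Poly V) → Poly V
  altΣ {m = zero}  v = con 0#
  altΣ {m = suc m} v = head v ⊖ altΣ (tail v)

  -- Stable polynomials in x (components f n ∈ F[x₁,…,xₙ], variables
  -- 0-indexed by Fin n) and in p,q (components h m ∈ F[p₁..pₘ,q₁..qₘ],
  -- variables inj₁ i = p_{i+1}, inj₂ i = q_{i+1}).

  XPoly : Set c
  XPoly = (n : ℕ) → Poly (Fin n)

  PQVar : ℕ → Set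
  PQVar m = Fin m ⊎ Fin m

  PQPoly : Set c
  PQPoly = (m : ℕ) → Poly (PQVar m)

  ext0 : {n : ℕ} → Vector Carrier n → Vector Carrier (suc n)
  ext0 {zero}  ρ = 0# ∷ []
  ext0 {suc n} ρ = head ρ ∷ ext0 (tail ρ)

  IsStableX : XPoly → Set (c ⊔ ℓ)
  IsStableX f = ∀ n (ρ : Vector Carrier n) → ⟦ f (suc n) ⟧ (ext0 ρ) ≈ ⟦ f n ⟧ ρ

  IsStablePQ : PQPoly → Set (c ⊔ ℓ)
  IsStablePQ h = ∀ m (P Q : Vector Carrier m) →
    ⟦ h (suc m) ⟧ [ ext0 P , ext0 Q ] ≈ ⟦ h m ⟧ [ P , Q ]

  -- Sol: f_{n+2}(…, x_i, x_i, …) = f_n(…) (x_i, x_{i+1} equal, at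
  -- 0-indexed positions i, i+1 with i < n+1).

  ins2 : {n : ℕ} → Fin (suc n) → Carrier → Vector Carrier n → Vector Carrier (suc (suc n))
  ins2 {n}     fz     a ρ = a ∷ (a ∷ ρ)
  ins2 {suc n} (fs i) a ρ = head ρ ∷ ins2 i a (tail ρ)

  Sol : XPoly → Set (c ⊔ ℓ)
  Sol f = IsStableX f ×
    (∀ n (i : Fin (suc n)) (a : Carrier) (ρ : Vector Carrier n) →
       ⟦ f (suc (suc n)) ⟧ (ins2 i a ρ) ≈ ⟦ f n ⟧ ρ)

  -- For m = k+1 and (0-indexed) i ≤ k:
  --  mergeP i P = (p₁,…,p_{i-1}, p_i+p_{i+1}, p_{i+2},…) (last: p_m dropped)
  --  mergeQ i Q = (q₁,…,q_{i-2}, q_{i-1}+q_i, q_{i+1},…) (first: q₁ dropped)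
  -- (in 1-indexed notation for the paper's index i).

  mergeP : {k : ℕ} → Fin (suc k) → Vector Carrier (suc k) → Vector Carrier k
  mergeP {zero}  fz     P = []
  mergeP {suc k} fz     P = (head P +K head (tail P)) ∷ tail (tail P)
  mergeP {suc k} (fs i) P = head P ∷ mergeP i (tail P)

  mergeQ : {k : ℕ} → Fin (suc k) → Vector Carrier (suc k) → Vector Carrier k
  mergeQ {k}     fz          Q = tail Q
  mergeQ {suc k} (fs fz)     Q = (head Q +K head (tail Q)) ∷ tail (tail Q)
  mergeQ {suc k} (fs (fs i)) Q = head Q ∷ mergeQ (fs i) (tail Q)

  Sol′ : PQPoly → Set (c ⊔ ℓ)
  Sol′ h = IsStablePQ h ×
    ((∀ k (i : Fin (suc k)) (P : Vector Carrier (suc k)) (Q : Vector Carrier k) →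
        ⟦ h (suc k) ⟧ [ P , insertAt Q i 0# ] ≈ ⟦ h k ⟧ [ mergeP i P , Q ]) ×
     (∀ k (i : Fin (suc k)) (P : Vector Carrier k) (Q : Vector Carrier (suc k)) →
        ⟦ h (suc k) ⟧ [ insertAt P i 0# , Q ] ≈ ⟦ h k ⟧ [ P , mergeQ i Q ]))

  -- Φ_{x→p,q}:  h_m = f_{2m+1}(x₁,…,x_{2m+1}) with (1-indexed)
  --   x_{2i+1} = (q_{i+1}+⋯+q_m) − (p₁+⋯+p_i),
  --   x_{2i}   = (q_i+⋯+q_m)   − (p₁+⋯+p_i).
  -- With 0-indexed j (x_{j+1}) and 0-indexed p,q this is
  --   x = Σ_{k ≥ ⌊j/2⌋} q_k − Σ_{k < ⌈j/2⌉} p_k.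

  qTail : (m s : ℕ) → Poly (PQVar m)
  qTail m s = ΣF (λ (k : Fin m) → if toℕ k <ᵇ s then con 0# else var (inj₂ k))

  pHead : (m s : ℕ) → Poly (PQVar m)
  pHead m s = ΣF (λ (k : Fin m) → if toℕ k <ᵇ s then var (inj₁ k) else con 0#)

  xOfPQ : (m : ℕ) → Fin (suc (2 * m)) → Poly (PQVar m)
  xOfPQ m j = qTail m (toℕ j / 2) ⊖ pHead m ((suc (toℕ j)) / 2)

  Φx→pq : XPoly → PQPoly
  Φx→pq f m = subst (f (suc (2 * m))) (xOfPQ m)

  -- Φ_{p,q→x}:  component n is h_{⌊n/2⌋}(p, q) with (1-indexed)
  --   p_i = x_{2i−1} − x_{2i},  q_i = x_{2i} − x_{2i+1},
  -- where x_j := 0 for j > n (so the component 2m+1 is exactly the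
  -- paper's formula, and component 2m is component 2m+1 at x_{2m+1}=0,
  -- as forced by stability).

  xv : (n j : ℕ) → Poly (Fin n)
  xv zero    j       = con 0#
  xv (suc n) zero    = var fz
  xv (suc n) (suc j) = subst (xv n j) (λ i → var (fs i))

  pqOfX : (n : ℕ) → PQVar (n / 2) → Poly (Fin n)
  pqOfX n (inj₁ i) = xv n (2 * toℕ i) ⊖ xv n (suc (2 * toℕ i))
  pqOfX n (inj₂ i) = xv n (suc (2 * toℕ i)) ⊖ xv n (suc (suc (2 * toℕ i)))

  Φpq→x : PQPoly → XPoly
  Φpq→x h n = subst (h (n / 2)) (pqOfX n)

  M₁ : XPoly
  M₁ n = altΣ (λ (j : Fin n) → var j)

  zeroPQ : PQPoly
  zeroPQ m = con 0#

  InIdealM₁ : XPoly → Set (c ⊔ ℓ)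
  InIdealM₁ f = Σ XPoly (λ g → Sol g × (∀ n → f n ≐ (M₁ n ⊗ g n)))

-- The point x(p, q) substituted by Φx→pq has x_{2i−1} − x_{2i} = p_i and x_{2i} − x_{2i+1} = q_i,
-- so the differences taken by Φpq→x give back (p, q): this is the first identity.  Its
-- alternating sum M₁ is zero, and conversely every point with M₁ = 0 is x(p, q) for its own
-- differences; so Φx→pq f = 0 exactly when f vanishes on the hyperplane M₁ = 0 (in even
-- arity by stability).  Such an f is a multiple of M₁: writing f − f(x₁ − M₁, x₂, …) = M₁ · g
-- with g a divided difference in x₁, the subtracted term vanishes.  Finally g lies in Sol
-- because M₁ can be cancelled from polynomial identities over a field of characteristic zero,
-- which is infinite.
module Submission where

open import Defs
open import Level using (Level)
open import Data.Product using (_×_)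
open import Function.Bundles using (_⇔_)

open import Algebra.Bundles using (CommutativeRing)
import Algebra.Properties.AbelianGroup as AbelianGroupProperties
import Algebra.Properties.Group as GroupProperties
import Algebra.Properties.Ring as RingProperties
import Algebra.Properties.Semiring.Mult as SemiringMult
open import Algebra.Solver.Ring.AlmostCommutativeRing using (fromCommutativeRing; _-Raw-AlmostCommutative⟶_)
open import Data.Bool using (true; false; if_then_else_)
open import Data.Fin using (Fin; toℕ; fromℕ<) renaming (zero to fz; suc to fs)
import Data.Fin.Properties as Fin
open import Data.Integer as ℤ using (ℤ; +_; -[1+_])
import Data.Integer.Properties as ℤ
open import Data.List using (List; []; _∷_; length; map)
open import Data.Maybe using (Maybe; just; nothing)
open import Data.Nat using (ℕ; zero; suc; _+_; _*_; _/_; _<ᵇ_; _≤_; _<_; z≤n; s≤s)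
open import Data.Nat.DivMod using (m*n/n≡m; m/n≡1+[m∸n]/n)
import Data.Nat.Properties as ℕ
open import Data.Product using (_,_; proj₁; proj₂)
open import Data.Sum using (inj₁; inj₂; [_,_])
open import Data.Unit using (⊤; tt)
open import Data.Vec.Functional using (Vector; head; tail) renaming ([] to []ᵛ; _∷_ to _∷ᵛ_)
open import Function.Base using (_∘_)
open import Function.Bundles using (mk⇔)
open import Relation.Binary.PropositionalEquality as ≡ using (_≡_)
import Relation.Binary.Reasoning.Setoid as SetoidReasoning
open import Relation.Nullary using (¬_; yes; no)

[2+n]/2≡1+n/2 : ∀ n → suc (suc n) / 2 ≡ suc (n / 2)
[2+n]/2≡1+n/2 n = m/n≡1+[m∸n]/n {suc (suc n)} {2} (s≤s (s≤s z≤n))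

2*n/2≡n : ∀ n → 2 * n / 2 ≡ n
2*n/2≡n n = ≡.trans (≡.cong (_/ 2) (ℕ.*-comm 2 n)) (m*n/n≡m n 2)

[1+2*n]/2≡n : ∀ n → suc (2 * n) / 2 ≡ n
[1+2*n]/2≡n zero    = ≡.refl
[1+2*n]/2≡n (suc n) = begin
  suc (2 * suc n) / 2          ≡⟨ ≡.cong (λ k → suc k / 2) (ℕ.*-suc 2 n) ⟩
  suc (suc (suc (2 * n))) / 2  ≡⟨ [2+n]/2≡1+n/2 (suc (2 * n)) ⟩
  suc (suc (2 * n) / 2)        ≡⟨ ≡.cong suc ([1+2*n]/2≡n n) ⟩
  suc n                        ∎
  where open ≡.≡-Reasoning

[2+2*n]/2≡1+n : ∀ n → suc (suc (2 * n)) / 2 ≡ suc n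
[2+2*n]/2≡1+n n = ≡.trans ([2+n]/2≡1+n/2 (2 * n)) (≡.cong suc (2*n/2≡n n))

[3+2*n]/2≡1+n : ∀ n → suc (suc (suc (2 * n))) / 2 ≡ suc n
[3+2*n]/2≡1+n n = ≡.trans ([2+n]/2≡1+n/2 (suc (2 * n))) (≡.cong suc ([1+2*n]/2≡n n))

data Parity : ℕ → Set where
  even : ∀ k → Parity (2 * k)
  odd  : ∀ k → Parity (suc (2 * k))

parity : ∀ n → Parity n
parity zero = even 0
parity (suc n) with parity n
... | even k = odd k
... | odd k  = ≡.subst Parity (ℕ.*-suc 2 k) (even (suc k))

-- The ring solver only cancels monomials whose coefficients it can decide equal, so it is run
-- with integer coefficients through this morphism.

module IntegerMorphism {c ℓ : Level} (R : CommutativeRing c ℓ) where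
  open CommutativeRing R renaming (_+_ to _+K_; _*_ to _*K_; -_ to -K_)
  open RingProperties ring using (-0#≈0#; -‿involutive; -‿distribˡ-*; -‿distribʳ-*)
  open AbelianGroupProperties +-abelianGroup using (⁻¹-∙-comm)
  open SemiringMult semiring using (×-homo-+; ×1-homo-*) renaming (_×_ to _·_)
  open SetoidReasoning setoid

  fromℤ : ℤ → Carrier
  fromℤ (+ n)    = n · 1#
  fromℤ -[1+ n ] = -K (suc n · 1#)

  fromℤ-neg : ∀ i → fromℤ (ℤ.- i) ≈ -K fromℤ i
  fromℤ-neg (+ zero)  = sym -0#≈0#
  fromℤ-neg (+ suc n) = refl
  fromℤ-neg -[1+ n ]  = sym (-‿involutive _)

  fromℤ-⊖ : ∀ m n → fromℤ (m ℤ.⊖ n) ≈ m · 1# +K -K (n · 1#)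
  fromℤ-⊖ m       zero    = sym (trans (+-congˡ -0#≈0#) (+-identityʳ _))
  fromℤ-⊖ zero    (suc n) = sym (+-identityˡ _)
  fromℤ-⊖ (suc m) (suc n) = begin
    fromℤ (suc m ℤ.⊖ suc n)                   ≡⟨ ≡.cong fromℤ (ℤ.[1+m]⊖[1+n]≡m⊖n m n) ⟩
    fromℤ (m ℤ.⊖ n)                           ≈⟨ fromℤ-⊖ m n ⟩
    m · 1# +K -K (n · 1#)                     ≈⟨ +-congʳ (+-identityʳ _) ⟨
    (m · 1# +K 0#) +K -K (n · 1#)             ≈⟨ +-congʳ (+-congˡ (-‿inverseʳ 1#)) ⟨
    (m · 1# +K (1# +K -K 1#)) +K -K (n · 1#)  ≈⟨ +-congʳ (trans (sym (+-assoc _ _ _)) (+-congʳ (+-comm _ _))) ⟩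
    ((1# +K m · 1#) +K -K 1#) +K -K (n · 1#)  ≈⟨ +-assoc _ _ _ ⟩
    (1# +K m · 1#) +K (-K 1# +K -K (n · 1#))  ≈⟨ +-congˡ (⁻¹-∙-comm 1# (n · 1#)) ⟩
    (1# +K m · 1#) +K -K (1# +K n · 1#)       ∎

  fromℤ-+ : ∀ i j → fromℤ (i ℤ.+ j) ≈ fromℤ i +K fromℤ j
  fromℤ-+ (+ m)    (+ n)    = ×-homo-+ 1# m n
  fromℤ-+ (+ m)    -[1+ n ] = fromℤ-⊖ m (suc n)
  fromℤ-+ -[1+ m ] (+ n)    = trans (fromℤ-⊖ n (suc m)) (+-comm _ _)
  fromℤ-+ -[1+ m ] -[1+ n ] = begin
    -K (suc (suc (m + n)) · 1#)         ≡⟨ ≡.cong (λ k → -K (suc k · 1#)) (≡.sym (ℕ.+-suc m n)) ⟩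
    -K ((suc m + suc n) · 1#)           ≈⟨ -‿cong (×-homo-+ 1# (suc m) (suc n)) ⟩
    -K (suc m · 1# +K suc n · 1#)       ≈⟨ ⁻¹-∙-comm _ _ ⟨
    -K (suc m · 1#) +K -K (suc n · 1#)  ∎

  fromℤ-+-* : ∀ m j → fromℤ (+ m ℤ.* j) ≈ m · 1# *K fromℤ j
  fromℤ-+-* m (+ n)    = trans (reflexive (≡.cong fromℤ (≡.sym (ℤ.pos-* m n)))) (×1-homo-* m n)
  fromℤ-+-* m -[1+ n ] = begin
    fromℤ (+ m ℤ.* -[1+ n ])         ≡⟨ ≡.cong fromℤ (≡.sym (ℤ.neg-distribʳ-* (+ m) (+ suc n))) ⟩
    fromℤ (ℤ.- (+ m ℤ.* + suc n))    ≈⟨ fromℤ-neg (+ m ℤ.* + suc n) ⟩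
    -K fromℤ (+ m ℤ.* + suc n)       ≈⟨ -‿cong (fromℤ-+-* m (+ suc n)) ⟩
    -K (m · 1# *K (suc n · 1#))      ≈⟨ -‿distribʳ-* _ _ ⟩
    m · 1# *K -K (suc n · 1#)        ∎

  fromℤ-* : ∀ i j → fromℤ (i ℤ.* j) ≈ fromℤ i *K fromℤ j
  fromℤ-* (+ m)    j = fromℤ-+-* m j
  fromℤ-* -[1+ m ] j = begin
    fromℤ (-[1+ m ] ℤ.* j)           ≡⟨ ≡.cong fromℤ (≡.sym (ℤ.neg-distribˡ-* (+ suc m) j)) ⟩
    fromℤ (ℤ.- (+ suc m ℤ.* j))      ≈⟨ fromℤ-neg (+ suc m ℤ.* j) ⟩
    -K fromℤ (+ suc m ℤ.* j)         ≈⟨ -‿cong (fromℤ-+-* (suc m) j) ⟩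
    -K (suc m · 1# *K fromℤ j)       ≈⟨ -‿distribˡ-* _ _ ⟩
    -K (suc m · 1#) *K fromℤ j       ∎

  fromℤ-homomorphism : ℤ.+-*-rawRing -Raw-AlmostCommutative⟶ fromCommutativeRing R
  fromℤ-homomorphism = record
    { ⟦_⟧    = fromℤ
    ; +-homo = fromℤ-+
    ; *-homo = fromℤ-*
    ; -‿homo = fromℤ-neg
    ; 0-homo = refl
    ; 1-homo = +-identityʳ 1#
    }

  fromℤ-≟ : ∀ i j → Maybe (fromℤ i ≈ fromℤ j)
  fromℤ-≟ i j with i ℤ.≟ j
  ... | yes ≡.refl = just refl
  ... | no _       = nothing

module _ {c ℓ : Level} (F : CharZeroField c ℓ) where
  open CharZeroField F
  open RingProperties ring using (-0#≈0#; -‿distribˡ-*; -‿distribʳ-*)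
  open GroupProperties +-group using (x∙y⁻¹≈ε⇒x≈y; x≈y⇒x∙y⁻¹≈ε)
  open IntegerMorphism cring using (fromℤ-homomorphism; fromℤ-≟)
  open SetoidReasoning setoid
  open import Algebra.Solver.Ring ℤ.+-*-rawRing (fromCommutativeRing cring) fromℤ-homomorphism fromℤ-≟
    using (solve; _:+_; _:*_; :-_; _:-_; _:=_) renaming (con to κ)

  infixl 6 _-K_
  _-K_ : Carrier → Carrier → Carrier
  x -K y = x +K (-K y)

  fromℕ : ℕ → Carrier
  fromℕ = ringFromℕ cring

  x-0≈x : ∀ x → x -K 0# ≈ x
  x-0≈x x = trans (+-congˡ -0#≈0#) (+-identityʳ x)

  a-b≈x-y⇒a-x≈b-y : ∀ {a b x y} → a -K b ≈ x -K y → a -K x ≈ b -K y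
  a-b≈x-y⇒a-x≈b-y {a} {b} {x} {y} a-b≈x-y = x∙y⁻¹≈ε⇒x≈y _ _ (begin
    (a -K x) -K (b -K y)  ≈⟨ solve 4 (λ a b x y → (a :- x) :- (b :- y) := (a :- b) :- (x :- y)) refl a b x y ⟩
    (a -K b) -K (x -K y)  ≈⟨ x≈y⇒x∙y⁻¹≈ε a-b≈x-y ⟩
    0#                    ∎)

  x≉0∧x*y≈0⇒y≈0 : ∀ {x y} → ¬ (x ≈ 0#) → x *K y ≈ 0# → y ≈ 0#
  x≉0∧x*y≈0⇒y≈0 {x} {y} x≉0 xy≈0 with inverse x x≉0
  ... | x⁻¹ , xx⁻¹≈1 = begin
    y                ≈⟨ *-identityˡ y ⟨
    1# *K y          ≈⟨ *-congʳ xx⁻¹≈1 ⟨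
    (x *K x⁻¹) *K y  ≈⟨ *-congʳ (*-comm x x⁻¹) ⟩
    (x⁻¹ *K x) *K y  ≈⟨ *-assoc x⁻¹ x y ⟩
    x⁻¹ *K (x *K y)  ≈⟨ *-congˡ xy≈0 ⟩
    x⁻¹ *K 0#        ≈⟨ zeroʳ x⁻¹ ⟩
    0#               ∎

  eval : {V : Set} → Poly F V → (V → Carrier) → Carrier
  eval = ⟦_⟧ F

  eval-cong : ∀ {V : Set} (p : Poly F V) {ρ ρ′ : V → Carrier} → (∀ v → ρ v ≈ ρ′ v) → eval p ρ ≈ eval p ρ′
  eval-cong (con a) ρ≈ρ′ = refl
  eval-cong (var v) ρ≈ρ′ = ρ≈ρ′ v
  eval-cong (p ⊕ q) ρ≈ρ′ = +-cong (eval-cong p ρ≈ρ′) (eval-cong q ρ≈ρ′)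
  eval-cong (p ⊗ q) ρ≈ρ′ = *-cong (eval-cong p ρ≈ρ′) (eval-cong q ρ≈ρ′)
  eval-cong (⊝ p)   ρ≈ρ′ = -‿cong (eval-cong p ρ≈ρ′)

  eval-subst : ∀ {V W : Set} (p : Poly F V) (σ : V → Poly F W) (ρ : W → Carrier) →
    eval (subst F p σ) ρ ≈ eval p (λ v → eval (σ v) ρ)
  eval-subst (con a) σ ρ = refl
  eval-subst (var v) σ ρ = refl
  eval-subst (p ⊕ q) σ ρ = +-cong (eval-subst p σ ρ) (eval-subst q σ ρ)
  eval-subst (p ⊗ q) σ ρ = *-cong (eval-subst p σ ρ) (eval-subst q σ ρ)
  eval-subst (⊝ p)   σ ρ = -‿cong (eval-subst p σ ρ)

  sumᵛ : ∀ {n} → Vector Carrier n → Carrier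
  sumᵛ {zero}  u = 0#
  sumᵛ {suc n} u = head u +K sumᵛ (tail u)

  sumᵛ-cong : ∀ {n} {u v : Vector Carrier n} → (∀ j → u j ≈ v j) → sumᵛ u ≈ sumᵛ v
  sumᵛ-cong {zero}  u≈v = refl
  sumᵛ-cong {suc n} u≈v = +-cong (u≈v fz) (sumᵛ-cong (u≈v ∘ fs))

  eval-ΣF : ∀ {V : Set} {n} (w : Fin n → Poly F V) ρ → eval (ΣF F w) ρ ≈ sumᵛ (λ j → eval (w j) ρ)
  eval-ΣF {n = zero}  w ρ = refl
  eval-ΣF {n = suc n} w ρ = +-congˡ (eval-ΣF (tail w) ρ)

  alt : ∀ {n} → Vector Carrier n → Carrier
  alt {zero}  u = 0#
  alt {suc n} u = head u -K alt (tail u)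

  eval-altΣ : ∀ {V : Set} {n} (w : Fin n → Poly F V) ρ → eval (altΣ F w) ρ ≈ alt (λ j → eval (w j) ρ)
  eval-altΣ {n = zero}  w ρ = refl
  eval-altΣ {n = suc n} w ρ = +-congˡ (-‿cong (eval-altΣ (tail w) ρ))

  eval-M₁ : ∀ n (ρ : Vector Carrier n) → eval (M₁ F n) ρ ≈ alt ρ
  eval-M₁ n = eval-altΣ var

  alt-ext0 : ∀ {n} (ρ : Vector Carrier n) → alt (ext0 F ρ) ≈ alt ρ
  alt-ext0 {zero}  ρ = -‿inverseʳ 0#
  alt-ext0 {suc n} ρ = +-congˡ (-‿cong (alt-ext0 (tail ρ)))

  alt-ins2 : ∀ {n} (i : Fin (suc n)) a (ρ : Vector Carrier n) → alt (ins2 F i a ρ) ≈ alt ρ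
  alt-ins2         fz     a ρ = solve 2 (λ a A → a :- (a :- A) := A) refl a (alt ρ)
  alt-ins2 {suc n} (fs i) a ρ = +-congˡ (-‿cong (alt-ins2 i a (tail ρ)))

  at : ∀ {n} → Vector Carrier n → ℕ → Carrier
  at {zero}  ζ j       = 0#
  at {suc n} ζ zero    = head ζ
  at {suc n} ζ (suc j) = at (tail ζ) j

  at-toℕ : ∀ {n} (ζ : Vector Carrier n) (k : Fin n) → at ζ (toℕ k) ≡ ζ k
  at-toℕ ζ fz     = ≡.refl
  at-toℕ ζ (fs k) = at-toℕ (tail ζ) k

  at-tabulate : ∀ {n} (ζ : Vector Carrier n) (g : ℕ → Carrier) →
    (∀ k → ζ k ≈ g (toℕ k)) → ∀ j → j < n → at ζ j ≈ g j
  at-tabulate {suc n} ζ g ζ≈g zero    _         = ζ≈g fz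
  at-tabulate {suc n} ζ g ζ≈g (suc j) (s≤s j<n) = at-tabulate (tail ζ) (g ∘ suc) (ζ≈g ∘ fs) j j<n

  eval-xv : ∀ n j (ρ : Vector Carrier n) → eval (xv F n j) ρ ≈ at ρ j
  eval-xv zero    j       ρ = refl
  eval-xv (suc n) zero    ρ = refl
  eval-xv (suc n) (suc j) ρ = trans (eval-subst (xv F n j) (var ∘ fs) ρ) (eval-xv n j (tail ρ))

  altFrom : ℕ → ℕ → (ℕ → Carrier) → Carrier
  altFrom zero    o g = 0#
  altFrom (suc n) o g = g o -K altFrom n (suc o) g

  altFrom-suc : ∀ n o g → altFrom n (suc o) g ≡ altFrom n o (g ∘ suc)
  altFrom-suc zero    o g = ≡.refl
  altFrom-suc (suc n) o g = ≡.cong (_-K_ (g (suc o))) (altFrom-suc n (suc o) g)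

  alt≈altFrom-at : ∀ {n} (ζ : Vector Carrier n) → alt ζ ≈ altFrom n 0 (at ζ)
  alt≈altFrom-at {zero}  ζ = refl
  alt≈altFrom-at {suc n} ζ =
    +-congˡ (-‿cong (trans (alt≈altFrom-at (tail ζ)) (reflexive (≡.sym (altFrom-suc n 0 (at ζ))))))

  altFrom-cong : ∀ n o g h → (∀ j → j < o + n → g j ≈ h j) → altFrom n o g ≈ altFrom n o h
  altFrom-cong zero    o g h g≈h = refl
  altFrom-cong (suc n) o g h g≈h = +-cong (g≈h o (ℕ.m<m+n o (s≤s z≤n)))
    (-‿cong (altFrom-cong n (suc o) g h (λ j j<1+o+n → g≈h j (≡.subst (j <_) (≡.sym (ℕ.+-suc o n)) j<1+o+n))))

  altFrom-const : ∀ n o x → altFrom (suc (2 * n)) o (λ _ → x) ≈ x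
  altFrom-const zero    o x = x-0≈x x
  altFrom-const (suc n) o x = begin
    altFrom (suc (2 * suc n)) o (λ _ → x)
      ≡⟨ ≡.cong (λ k → altFrom (suc k) o (λ _ → x)) (ℕ.*-suc 2 n) ⟩
    x -K (x -K altFrom (suc (2 * n)) (suc (suc o)) (λ _ → x))
      ≈⟨ +-congˡ (-‿cong (+-congˡ (-‿cong (altFrom-const n (suc (suc o)) x)))) ⟩
    x -K (x -K x)
      ≈⟨ solve 1 (λ x → x :- (x :- x) := x) refl x ⟩
    x ∎

  altFrom-∸ : ∀ n o g h → altFrom n o (λ j → g j -K h j) ≈ altFrom n o g -K altFrom n o h
  altFrom-∸ zero    o g h = sym (x-0≈x 0#)
  altFrom-∸ (suc n) o g h = trans (+-congˡ (-‿cong (altFrom-∸ n (suc o) g h)))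
    (solve 4 (λ a b A B → (a :- b) :- (A :- B) := (a :- A) :- (b :- B)) refl
             (g o) (h o) (altFrom n (suc o) g) (altFrom n (suc o) h))

  -- Univariate polynomials and cancellation of M₁

  horner : List Carrier → Carrier → Carrier
  horner []       t = 0#
  horner (a ∷ as) t = a +K t *K horner as t

  horner-cong : ∀ as {t t′} → t ≈ t′ → horner as t ≈ horner as t′
  horner-cong []       t≈t′ = refl
  horner-cong (a ∷ as) t≈t′ = +-congˡ (*-cong t≈t′ (horner-cong as t≈t′))

  _+ᴸ_ : List Carrier → List Carrier → List Carrier
  []       +ᴸ bs       = bs
  (a ∷ as) +ᴸ []       = a ∷ as
  (a ∷ as) +ᴸ (b ∷ bs) = (a +K b) ∷ (as +ᴸ bs)

  _·ᴸ_ : Carrier → List Carrier → List Carrier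
  a ·ᴸ bs = map (a *K_) bs

  _*ᴸ_ : List Carrier → List Carrier → List Carrier
  []       *ᴸ bs = []
  (a ∷ as) *ᴸ bs = (a ·ᴸ bs) +ᴸ (0# ∷ (as *ᴸ bs))

  horner-+ᴸ : ∀ as bs t → horner (as +ᴸ bs) t ≈ horner as t +K horner bs t
  horner-+ᴸ []       bs       t = sym (+-identityˡ _)
  horner-+ᴸ (a ∷ as) []       t = sym (+-identityʳ _)
  horner-+ᴸ (a ∷ as) (b ∷ bs) t = begin
    (a +K b) +K t *K horner (as +ᴸ bs) t
      ≈⟨ +-congˡ (*-congˡ (horner-+ᴸ as bs t)) ⟩
    (a +K b) +K t *K (A +K B)
      ≈⟨ solve 5 (λ a b t A B → (a :+ b) :+ t :* (A :+ B) := (a :+ t :* A) :+ (b :+ t :* B)) refl a b t A B ⟩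
    (a +K t *K A) +K (b +K t *K B) ∎
    where A = horner as t; B = horner bs t

  horner-·ᴸ : ∀ a bs t → horner (a ·ᴸ bs) t ≈ a *K horner bs t
  horner-·ᴸ a []       t = sym (zeroʳ a)
  horner-·ᴸ a (b ∷ bs) t = begin
    a *K b +K t *K horner (a ·ᴸ bs) t
      ≈⟨ +-congˡ (*-congˡ (horner-·ᴸ a bs t)) ⟩
    a *K b +K t *K (a *K B)
      ≈⟨ solve 4 (λ a b t B → a :* b :+ t :* (a :* B) := a :* (b :+ t :* B)) refl a b t B ⟩
    a *K (b +K t *K B) ∎
    where B = horner bs t

  horner-*ᴸ : ∀ as bs t → horner (as *ᴸ bs) t ≈ horner as t *K horner bs t
  horner-*ᴸ []       bs t = sym (zeroˡ _)
  horner-*ᴸ (a ∷ as) bs t = begin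
    horner ((a ·ᴸ bs) +ᴸ (0# ∷ (as *ᴸ bs))) t
      ≈⟨ horner-+ᴸ (a ·ᴸ bs) (0# ∷ (as *ᴸ bs)) t ⟩
    horner (a ·ᴸ bs) t +K (0# +K t *K horner (as *ᴸ bs) t)
      ≈⟨ +-cong (horner-·ᴸ a bs t) (+-congˡ (*-congˡ (horner-*ᴸ as bs t))) ⟩
    a *K B +K (0# +K t *K (A *K B))
      ≈⟨ solve 4 (λ a A B t → a :* B :+ (κ (+ 0) :+ t :* (A :* B)) := (a :+ t :* A) :* B) refl a A B t ⟩
    (a +K t *K A) *K B ∎
    where A = horner as t; B = horner bs t

  coefficients : Poly F ⊤ → List Carrier
  coefficients (con a) = a ∷ []
  coefficients (var _) = 0# ∷ 1# ∷ []
  coefficients (p ⊕ q) = coefficients p +ᴸ coefficients q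
  coefficients (p ⊗ q) = coefficients p *ᴸ coefficients q
  coefficients (⊝ p)   = (-K 1#) ·ᴸ coefficients p

  horner-coefficients : ∀ p t → horner (coefficients p) t ≈ eval p (λ _ → t)
  horner-coefficients (con a) t = solve 2 (λ a t → a :+ t :* κ (+ 0) := a) refl a t
  horner-coefficients (var _) t =
    trans (solve 2 (λ t o → κ (+ 0) :+ t :* (o :+ t :* κ (+ 0)) := t :* o) refl t 1#) (*-identityʳ t)
  horner-coefficients (p ⊕ q) t = trans (horner-+ᴸ (coefficients p) (coefficients q) t)
                                        (+-cong (horner-coefficients p t) (horner-coefficients q t))
  horner-coefficients (p ⊗ q) t = trans (horner-*ᴸ (coefficients p) (coefficients q) t)
                                        (*-cong (horner-coefficients p t) (horner-coefficients q t))
  horner-coefficients (⊝ p)   t = begin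
    horner ((-K 1#) ·ᴸ coefficients p) t   ≈⟨ horner-·ᴸ (-K 1#) (coefficients p) t ⟩
    -K 1# *K horner (coefficients p) t     ≈⟨ -‿distribˡ-* 1# _ ⟨
    -K (1# *K horner (coefficients p) t)   ≈⟨ -‿cong (trans (*-identityˡ _) (horner-coefficients p t)) ⟩
    -K eval p (λ _ → t)                    ∎

  deflate : Carrier → List Carrier → List Carrier
  deflate a []       = []
  deflate a (b ∷ bs) = horner (b ∷ bs) a ∷ deflate a bs

  length-deflate : ∀ a bs → length (deflate a bs) ≡ length bs
  length-deflate a []       = ≡.refl
  length-deflate a (b ∷ bs) = ≡.cong suc (length-deflate a bs)

  horner-deflate : ∀ a b bs t → horner (b ∷ bs) t -K horner (b ∷ bs) a ≈ (t -K a) *K horner (deflate a bs) t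
  horner-deflate a b []        t =
    solve 3 (λ a b t → (b :+ t :* κ (+ 0)) :- (b :+ a :* κ (+ 0)) := (t :- a) :* κ (+ 0)) refl a b t
  horner-deflate a b (b′ ∷ bs) t = begin
    (b +K t *K Pt) -K (b +K a *K Pa)
      ≈⟨ solve 5 (λ a b t Pt Pa → (b :+ t :* Pt) :- (b :+ a :* Pa) := (t :- a) :* Pa :+ t :* (Pt :- Pa)) refl a b t Pt Pa ⟩
    (t -K a) *K Pa +K t *K (Pt -K Pa)
      ≈⟨ +-congˡ (*-congˡ (horner-deflate a b′ bs t)) ⟩
    (t -K a) *K Pa +K t *K ((t -K a) *K Q)
      ≈⟨ solve 4 (λ a t Pa Q → (t :- a) :* Pa :+ t :* ((t :- a) :* Q) := (t :- a) :* (Pa :+ t :* Q)) refl a t Pa Q ⟩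
    (t -K a) *K (Pa +K t *K Q) ∎
    where
    Pt = horner (b′ ∷ bs) t
    Pa = horner (b′ ∷ bs) a
    Q  = horner (deflate a bs) t

  horner-vanishing : ∀ n as → length as ≡ n → ∀ s →
    (∀ j → j < n → horner as (s +K fromℕ (suc j)) ≈ 0#) → ∀ t → horner as t ≈ 0#
  horner-vanishing _       []       _      _ _     _ = refl
  horner-vanishing (suc n) (b ∷ bs) |as|≡n s roots t = begin
    horner as t                          ≈⟨ x-0≈x _ ⟨
    horner as t -K 0#                    ≈⟨ +-congˡ (-‿cong root-a) ⟨
    horner as t -K horner as a           ≈⟨ horner-deflate a b bs t ⟩
    (t -K a) *K horner (deflate a bs) t  ≈⟨ *-congˡ (deflate-vanishing t) ⟩
    (t -K a) *K 0#                       ≈⟨ zeroʳ _ ⟩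
    0#                                   ∎
    where
    as = b ∷ bs
    a  = s +K fromℕ 1
    root-a : horner as a ≈ 0#
    root-a = roots 0 (s≤s z≤n)
    deflate-roots : ∀ j → j < n → horner (deflate a bs) (a +K fromℕ (suc j)) ≈ 0#
    deflate-roots j j<n = x≉0∧x*y≈0⇒y≈0 r-a≉0 (begin
        (r -K a) *K horner (deflate a bs) r  ≈⟨ horner-deflate a b bs r ⟨
        horner as r -K horner as a           ≈⟨ +-cong root-r (-‿cong root-a) ⟩
        0# -K 0#                             ≈⟨ x-0≈x 0# ⟩
        0#                                   ∎)
      where
      r = a +K fromℕ (suc j)
      r-a≉0 : ¬ (r -K a ≈ 0#)
      r-a≉0 r-a≈0 = charZero j (trans (solve 2 (λ a f → f := (a :+ f) :- a) refl a (fromℕ (suc j))) r-a≈0)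
      r≈s+2+j : r ≈ s +K fromℕ (suc (suc j))
      r≈s+2+j = solve 3 (λ s o f → (s :+ (o :+ κ (+ 0))) :+ (o :+ f) := s :+ (o :+ (o :+ f))) refl s 1# (fromℕ j)
      root-r : horner as r ≈ 0#
      root-r = trans (horner-cong as r≈s+2+j) (roots (suc j) (s≤s j<n))
    deflate-vanishing : ∀ t → horner (deflate a bs) t ≈ 0#
    deflate-vanishing = horner-vanishing n (deflate a bs)
      (≡.trans (length-deflate a bs) (ℕ.suc-injective |as|≡n)) a deflate-roots

  vanishing-off-point⇒vanishing : ∀ (u : Poly F ⊤) s →
    (∀ t → ¬ (t ≈ s) → eval u (λ _ → t) ≈ 0#) → ∀ t → eval u (λ _ → t) ≈ 0#
  vanishing-off-point⇒vanishing u s vanishing t =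
    trans (sym (horner-coefficients u t)) (horner-vanishing _ (coefficients u) ≡.refl s roots t)
    where
    roots : ∀ j → j < length (coefficients u) → horner (coefficients u) (s +K fromℕ (suc j)) ≈ 0#
    roots j _ = trans (horner-coefficients u _) (vanishing _ s+1+j≉s)
      where
      s+1+j≉s : ¬ (s +K fromℕ (suc j) ≈ s)
      s+1+j≉s s+1+j≈s = charZero j (trans (solve 2 (λ s f → f := (s :+ f) :- s) refl s (fromℕ (suc j)))
                                          (x≈y⇒x∙y⁻¹≈ε s+1+j≈s))

  perturb₀ : ∀ {n} → Vector Carrier (suc n) → Fin (suc n) → Poly F ⊤
  perturb₀ ρ fz     = con (ρ fz) ⊕ var tt
  perturb₀ ρ (fs k) = con (ρ (fs k))

  -- Moving x₀ by t moves alt by t, so along that line P is a polynomial in t vanishing at all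
  -- but one point.
  vanishing-off-alt≈0⇒vanishing : ∀ {n} (P : Poly F (Fin (suc n))) →
    (∀ ρ → ¬ (alt ρ ≈ 0#) → eval P ρ ≈ 0#) → ∀ ρ → eval P ρ ≈ 0#
  vanishing-off-alt≈0⇒vanishing P vanishing ρ = begin
    eval P ρ           ≈⟨ eval-cong P ρ≈ρ+0 ⟩
    eval P (ρ+ 0#)     ≈⟨ eval-subst P (perturb₀ ρ) _ ⟨
    eval u (λ _ → 0#)  ≈⟨ vanishing-off-point⇒vanishing u s u-vanishing 0# ⟩
    0#                 ∎
    where
    u = subst F P (perturb₀ ρ)
    ρ+_ : Carrier → Vector Carrier _
    (ρ+ t) v = eval (perturb₀ ρ v) (λ _ → t)
    A = alt (tail ρ)
    s = A -K head ρ
    ρ≈ρ+0 : ∀ v → ρ v ≈ (ρ+ 0#) v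
    ρ≈ρ+0 fz     = sym (+-identityʳ _)
    ρ≈ρ+0 (fs k) = refl
    u-vanishing : ∀ t → ¬ (t ≈ s) → eval u (λ _ → t) ≈ 0#
    u-vanishing t t≉s = trans (eval-subst P (perturb₀ ρ) _) (vanishing (ρ+ t) alt≉0)
      where
      alt≉0 : ¬ (alt (ρ+ t) ≈ 0#)
      alt≉0 alt≈0 = t≉s (begin
        t                          ≈⟨ solve 3 (λ r t A → t := ((r :+ t) :- A) :+ (A :- r)) refl (head ρ) t A ⟩
        ((head ρ +K t) -K A) +K s  ≈⟨ +-congʳ alt≈0 ⟩
        0# +K s                    ≈⟨ +-identityˡ s ⟩
        s                          ∎)

  alt-*-cancelˡ : ∀ {n} (P Q : Poly F (Fin (suc n))) →
    (∀ ρ → alt ρ *K eval P ρ ≈ alt ρ *K eval Q ρ) → ∀ ρ → eval P ρ ≈ eval Q ρ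
  alt-*-cancelˡ P Q alt*P≈alt*Q ρ = x∙y⁻¹≈ε⇒x≈y _ _ (vanishing-off-alt≈0⇒vanishing (P ⊕ (⊝ Q)) P-Q≈0 ρ)
    where
    P-Q≈0 : ∀ ρ → ¬ (alt ρ ≈ 0#) → eval P ρ -K eval Q ρ ≈ 0#
    P-Q≈0 ρ alt≉0 = x≉0∧x*y≈0⇒y≈0 alt≉0 (begin
      alt ρ *K (eval P ρ -K eval Q ρ)
        ≈⟨ solve 3 (λ m a b → m :* (a :- b) := m :* a :- m :* b) refl (alt ρ) (eval P ρ) (eval Q ρ) ⟩
      alt ρ *K eval P ρ -K alt ρ *K eval Q ρ
        ≈⟨ x≈y⇒x∙y⁻¹≈ε (alt*P≈alt*Q ρ) ⟩
      0# ∎)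

  -- The coordinates x(p, q)

  sumFrom : ∀ {m} → Vector Carrier m → ℕ → Carrier
  sumFrom u s = sumᵛ (λ k → if toℕ k <ᵇ s then 0# else u k)

  sumBelow : ∀ {m} → Vector Carrier m → ℕ → Carrier
  sumBelow u s = sumᵛ (λ k → if toℕ k <ᵇ s then u k else 0#)

  sumFrom-suc : ∀ {m} (u : Vector Carrier m) (k : Fin m) → sumFrom u (toℕ k) ≈ u k +K sumFrom u (suc (toℕ k))
  sumFrom-suc u fz     = +-congˡ (sym (+-identityˡ _))
  sumFrom-suc u (fs k) = begin
    0# +K sumFrom (tail u) (toℕ k)  ≈⟨ +-congˡ (sumFrom-suc (tail u) k) ⟩
    0# +K (u (fs k) +K S)           ≈⟨ solve 2 (λ x S → κ (+ 0) :+ (x :+ S) := x :+ (κ (+ 0) :+ S)) refl (u (fs k)) S ⟩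
    u (fs k) +K (0# +K S)           ∎
    where S = sumFrom (tail u) (suc (toℕ k))

  sumFrom-all : ∀ {m} (u : Vector Carrier m) → sumFrom u m ≈ 0#
  sumFrom-all {zero}  u = refl
  sumFrom-all {suc m} u = trans (+-identityˡ _) (sumFrom-all (tail u))

  sumBelow-suc : ∀ {m} (u : Vector Carrier m) (k : Fin m) → sumBelow u (suc (toℕ k)) ≈ sumBelow u (toℕ k) +K u k
  sumBelow-suc u fz     = solve 2 (λ x S → x :+ S := (κ (+ 0) :+ S) :+ x) refl (u fz) (sumBelow (tail u) 0)
  sumBelow-suc u (fs k) = trans (+-congˡ (sumBelow-suc (tail u) k)) (sym (+-assoc _ _ _))

  sumBelow-zero : ∀ {m} (u : Vector Carrier m) → sumBelow u 0 ≈ 0#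
  sumBelow-zero {zero}  u = refl
  sumBelow-zero {suc m} u = trans (+-identityˡ _) (sumBelow-zero (tail u))

  pqCoord : ∀ {m} → Vector Carrier m → Vector Carrier m → ℕ → Carrier
  pqCoord p q j = sumFrom q (j / 2) -K sumBelow p (suc j / 2)

  eval-xOfPQ : ∀ m (ρ : PQVar F m → Carrier) (j : Fin (suc (2 * m))) →
    eval (xOfPQ F m j) ρ ≈ pqCoord (ρ ∘ inj₁) (ρ ∘ inj₂) (toℕ j)
  eval-xOfPQ m ρ j = +-cong
    (trans (eval-ΣF qTerm ρ) (sumᵛ-cong (λ k → eval-if (toℕ k <ᵇ toℕ j / 2) (con 0#) (var (inj₂ k)))))
    (-‿cong (trans (eval-ΣF pTerm ρ) (sumᵛ-cong (λ k → eval-if (toℕ k <ᵇ suc (toℕ j) / 2) (var (inj₁ k)) (con 0#)))))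
    where
    qTerm pTerm : Fin m → Poly F (PQVar F m)
    qTerm k = if toℕ k <ᵇ toℕ j / 2 then con 0# else var (inj₂ k)
    pTerm k = if toℕ k <ᵇ suc (toℕ j) / 2 then var (inj₁ k) else con 0#
    eval-if : ∀ b (x y : Poly F (PQVar F m)) → eval (if b then x else y) ρ ≈ (if b then eval x ρ else eval y ρ)
    eval-if true  x y = refl
    eval-if false x y = refl

  module _ {m : ℕ} (p q : Vector Carrier m) where

    pqCoord-even : ∀ i → pqCoord p q (2 * i) ≡ sumFrom q i -K sumBelow p i
    pqCoord-even i = ≡.cong₂ (λ a b → sumFrom q a -K sumBelow p b) (2*n/2≡n i) ([1+2*n]/2≡n i)

    pqCoord-odd : ∀ i → pqCoord p q (suc (2 * i)) ≡ sumFrom q i -K sumBelow p (suc i)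
    pqCoord-odd i = ≡.cong₂ (λ a b → sumFrom q a -K sumBelow p b) ([1+2*n]/2≡n i) ([2+2*n]/2≡1+n i)

    pqCoord-even-suc : ∀ i → pqCoord p q (suc (suc (2 * i))) ≡ sumFrom q (suc i) -K sumBelow p (suc i)
    pqCoord-even-suc i = ≡.cong₂ (λ a b → sumFrom q a -K sumBelow p b) ([2+2*n]/2≡1+n i) ([3+2*n]/2≡1+n i)

    pqCoord-p : ∀ (k : Fin m) → pqCoord p q (2 * toℕ k) -K pqCoord p q (suc (2 * toℕ k)) ≈ p k
    pqCoord-p k = begin
      pqCoord p q (2 * i) -K pqCoord p q (suc (2 * i))  ≡⟨ ≡.cong₂ _-K_ (pqCoord-even i) (pqCoord-odd i) ⟩
      (Q -K P) -K (Q -K sumBelow p (suc i))             ≈⟨ +-congˡ (-‿cong (+-congˡ (-‿cong (sumBelow-suc p k)))) ⟩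
      (Q -K P) -K (Q -K (P +K p k))                     ≈⟨ solve 3 (λ Q P x → (Q :- P) :- (Q :- (P :+ x)) := x) refl Q P (p k) ⟩
      p k                                               ∎
      where
      i = toℕ k
      Q = sumFrom q i
      P = sumBelow p i

    pqCoord-q : ∀ (k : Fin m) → pqCoord p q (suc (2 * toℕ k)) -K pqCoord p q (suc (suc (2 * toℕ k))) ≈ q k
    pqCoord-q k = begin
      pqCoord p q (suc (2 * i)) -K pqCoord p q (suc (suc (2 * i)))
        ≡⟨ ≡.cong₂ _-K_ (pqCoord-odd i) (pqCoord-even-suc i) ⟩
      (sumFrom q i -K P) -K (Q -K P)
        ≈⟨ +-congʳ (+-congʳ (sumFrom-suc q k)) ⟩
      ((q k +K Q) -K P) -K (Q -K P)
        ≈⟨ solve 3 (λ x Q P → ((x :+ Q) :- P) :- (Q :- P) := x) refl (q k) Q P ⟩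
      q k ∎
      where
      i = toℕ k
      Q = sumFrom q (suc i)
      P = sumBelow p (suc i)

    altFrom-pqCoord : ∀ d i → d + i ≡ m → altFrom (suc (2 * d)) (2 * i) (pqCoord p q) ≈ -K sumBelow p i
    altFrom-pqCoord zero i ≡.refl = begin
      pqCoord p q (2 * i) -K 0#    ≈⟨ x-0≈x _ ⟩
      pqCoord p q (2 * i)          ≡⟨ pqCoord-even i ⟩
      sumFrom q i -K sumBelow p i  ≈⟨ +-congʳ (sumFrom-all q) ⟩
      0# -K sumBelow p i           ≈⟨ +-identityˡ _ ⟩
      -K sumBelow p i              ∎
    altFrom-pqCoord (suc d) i d+i≡m = begin
      altFrom (suc (2 * suc d)) (2 * i) x
        ≡⟨ ≡.cong (λ n → altFrom (suc n) (2 * i) x) (ℕ.*-suc 2 d) ⟩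
      x (2 * i) -K (x (suc (2 * i)) -K altFrom (suc (2 * d)) (suc (suc (2 * i))) x)
        ≡⟨ ≡.cong (λ o → x (2 * i) -K (x (suc (2 * i)) -K altFrom (suc (2 * d)) o x)) (≡.sym (ℕ.*-suc 2 i)) ⟩
      x (2 * i) -K (x (suc (2 * i)) -K altFrom (suc (2 * d)) (2 * suc i) x)
        ≈⟨ +-congˡ (-‿cong (+-congˡ (-‿cong (altFrom-pqCoord d (suc i) (≡.trans (ℕ.+-suc d i) d+i≡m))))) ⟩
      x (2 * i) -K (x (suc (2 * i)) -K (-K sumBelow p (suc i)))
        ≈⟨ solve 3 (λ a b P → a :- (b :- (:- P)) := (a :- b) :- P) refl (x (2 * i)) (x (suc (2 * i))) (sumBelow p (suc i)) ⟩
      (x (2 * i) -K x (suc (2 * i))) -K sumBelow p (suc i)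
        ≈⟨ +-cong (≡.subst (λ i → x (2 * i) -K x (suc (2 * i)) ≈ p k) toℕk≡i (pqCoord-p k))
                  (-‿cong (≡.subst (λ i → sumBelow p (suc i) ≈ sumBelow p i +K p k) toℕk≡i (sumBelow-suc p k))) ⟩
      p k -K (sumBelow p i +K p k)
        ≈⟨ solve 2 (λ x P → x :- (P :+ x) := :- P) refl (p k) (sumBelow p i) ⟩
      -K sumBelow p i ∎
      where
      x = pqCoord p q
      i<m : i < m
      i<m = ≡.subst (i <_) d+i≡m (s≤s (ℕ.m≤n+m i d))
      k = fromℕ< i<m
      toℕk≡i : toℕ k ≡ i
      toℕk≡i = Fin.toℕ-fromℕ< i<m

    altFrom-pqCoord≈0 : altFrom (suc (2 * m)) 0 (pqCoord p q) ≈ 0#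
    altFrom-pqCoord≈0 = trans (altFrom-pqCoord m 0 (ℕ.+-identityʳ m)) (trans (-‿cong (sumBelow-zero p)) -0#≈0#)

  alt-xOfPQ : ∀ m (ρ : PQVar F m → Carrier) → alt (λ j → eval (xOfPQ F m j) ρ) ≈ 0#
  alt-xOfPQ m ρ = begin
    alt ζ                           ≈⟨ alt≈altFrom-at ζ ⟩
    altFrom (suc (2 * m)) 0 (at ζ)  ≈⟨ altFrom-cong _ 0 _ _ (at-tabulate ζ x (eval-xOfPQ m ρ)) ⟩
    altFrom (suc (2 * m)) 0 x       ≈⟨ altFrom-pqCoord≈0 (ρ ∘ inj₁) (ρ ∘ inj₂) ⟩
    0#                              ∎
    where
    ζ = λ j → eval (xOfPQ F m j) ρ
    x = pqCoord (ρ ∘ inj₁) (ρ ∘ inj₂)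

  differences : ∀ {m} → Vector Carrier (suc (2 * m)) → PQVar F m → Carrier
  differences ζ (inj₁ k) = at ζ (2 * toℕ k) -K at ζ (suc (2 * toℕ k))
  differences ζ (inj₂ k) = at ζ (suc (2 * toℕ k)) -K at ζ (suc (suc (2 * toℕ k)))

  -- The gap between ζ and the point with the same differences is constant, and its alternating
  -- sum over an odd number of entries is that constant, hence zero.
  alt≈0⇒xOfPQ-differences : ∀ m (ζ : Vector Carrier (suc (2 * m))) → alt ζ ≈ 0# →
    ∀ j → ζ j ≈ eval (xOfPQ F m j) (differences ζ)
  alt≈0⇒xOfPQ-differences m ζ alt≈0 j = begin
    ζ j                                 ≡⟨ at-toℕ ζ j ⟨
    at ζ (toℕ j)                        ≈⟨ x∙y⁻¹≈ε⇒x≈y _ _ (trans (gap-constant (toℕ j) j≤2m) gap₀≈0) ⟩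
    pqCoord p q (toℕ j)                 ≈⟨ eval-xOfPQ m (differences ζ) j ⟨
    eval (xOfPQ F m j) (differences ζ)  ∎
    where
    p = differences ζ ∘ inj₁
    q = differences ζ ∘ inj₂
    j≤2m = ℕ.≤-pred (Fin.toℕ<n j)
    gap : ℕ → Carrier
    gap j = at ζ j -K pqCoord p q j
    gap-suc : ∀ j → suc j ≤ 2 * m → gap j ≈ gap (suc j)
    gap-suc j 1+j≤2m with parity j
    ... | even i = ≡.subst (λ t → gap (2 * t) ≈ gap (suc (2 * t))) (Fin.toℕ-fromℕ< i<m)
                     (a-b≈x-y⇒a-x≈b-y (sym (pqCoord-p p q (fromℕ< i<m))))
      where i<m = ℕ.*-cancelˡ-< 2 i m 1+j≤2m
    ... | odd i  = ≡.subst (λ t → gap (suc (2 * t)) ≈ gap (suc (suc (2 * t)))) (Fin.toℕ-fromℕ< i<m)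
                     (a-b≈x-y⇒a-x≈b-y (sym (pqCoord-q p q (fromℕ< i<m))))
      where i<m = ℕ.*-cancelˡ-< 2 i m (ℕ.≤-trans (ℕ.n≤1+n _) 1+j≤2m)
    gap-constant : ∀ j → j ≤ 2 * m → gap j ≈ gap 0
    gap-constant zero    _      = refl
    gap-constant (suc j) 1+j≤2m = trans (sym (gap-suc j 1+j≤2m)) (gap-constant j (ℕ.≤-trans (ℕ.n≤1+n j) 1+j≤2m))
    gap₀≈0 : gap 0 ≈ 0#
    gap₀≈0 = begin
      gap 0
        ≈⟨ altFrom-const m 0 (gap 0) ⟨
      altFrom (suc (2 * m)) 0 (λ _ → gap 0)
        ≈⟨ altFrom-cong _ 0 _ _ (λ j j<n → sym (gap-constant j (ℕ.≤-pred j<n))) ⟩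
      altFrom (suc (2 * m)) 0 gap
        ≈⟨ altFrom-∸ (suc (2 * m)) 0 (at ζ) (pqCoord p q) ⟩
      altFrom (suc (2 * m)) 0 (at ζ) -K altFrom (suc (2 * m)) 0 (pqCoord p q)
        ≈⟨ +-cong (sym (alt≈altFrom-at ζ)) (-‿cong (altFrom-pqCoord≈0 p q)) ⟩
      alt ζ -K 0#
        ≈⟨ trans (x-0≈x _) alt≈0 ⟩
      0# ∎

  eval-reindex : ∀ (h : PQPoly F) {k m} (k≡m : k ≡ m) (τ : PQVar F k → Carrier) (ρ : PQVar F m → Carrier) →
    (∀ i → τ (inj₁ i) ≈ ρ (inj₁ (≡.subst Fin k≡m i))) →
    (∀ i → τ (inj₂ i) ≈ ρ (inj₂ (≡.subst Fin k≡m i))) →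
    eval (h k) τ ≈ eval (h m) ρ
  eval-reindex h ≡.refl τ ρ τ≈ρ₁ τ≈ρ₂ = eval-cong (h _) [ τ≈ρ₁ , τ≈ρ₂ ]

  -- Holds for every h: Sol′ is only needed for Φpq→x h to land in Sol.
  Φx→pq∘Φpq→x≐id : ∀ (h : PQPoly F) m → _≐_ F (Φx→pq F (Φpq→x F h) m) (h m)
  Φx→pq∘Φpq→x≐id h m ρ = begin
    eval (subst F (subst F (h (n / 2)) (pqOfX F n)) (xOfPQ F m)) ρ
      ≈⟨ eval-subst (subst F (h (n / 2)) (pqOfX F n)) (xOfPQ F m) ρ ⟩
    eval (subst F (h (n / 2)) (pqOfX F n)) ζ
      ≈⟨ eval-subst (h (n / 2)) (pqOfX F n) ζ ⟩
    eval (h (n / 2)) (λ v → eval (pqOfX F n v) ζ)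
      ≈⟨ eval-reindex h n/2≡m _ ρ p-recovered q-recovered ⟩
    eval (h m) ρ ∎
    where
    n = suc (2 * m)
    n/2≡m = [1+2*n]/2≡n m
    p = ρ ∘ inj₁
    q = ρ ∘ inj₂
    ζ = λ j → eval (xOfPQ F m j) ρ
    ζ≈pqCoord : ∀ j → j < n → at ζ j ≈ pqCoord p q j
    ζ≈pqCoord = at-tabulate ζ (pqCoord p q) (eval-xOfPQ m ρ)
    2+2k<n : ∀ (k : Fin m) → suc (suc (2 * toℕ k)) < n
    2+2k<n k = s≤s (≡.subst (_≤ 2 * m) (ℕ.*-suc 2 (toℕ k)) (ℕ.*-monoʳ-≤ 2 (Fin.toℕ<n k)))
    1+2k<n : ∀ (k : Fin m) → suc (2 * toℕ k) < n
    1+2k<n k = ℕ.<-trans (ℕ.n<1+n _) (2+2k<n k)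
    2k<n : ∀ (k : Fin m) → 2 * toℕ k < n
    2k<n k = ℕ.<-trans (ℕ.n<1+n _) (1+2k<n k)
    toℕ-cast : ∀ i → toℕ (≡.subst Fin n/2≡m i) ≡ toℕ i
    toℕ-cast i = ≡.trans (≡.cong toℕ (Fin.subst-is-cast n/2≡m i)) (Fin.toℕ-cast n/2≡m i)
    p-recovered : ∀ i → eval (pqOfX F n (inj₁ i)) ζ ≈ p (≡.subst Fin n/2≡m i)
    p-recovered i = begin
      eval (xv F n (2 * toℕ i)) ζ -K eval (xv F n (suc (2 * toℕ i))) ζ
        ≈⟨ +-cong (eval-xv n (2 * toℕ i) ζ) (-‿cong (eval-xv n (suc (2 * toℕ i)) ζ)) ⟩
      at ζ (2 * toℕ i) -K at ζ (suc (2 * toℕ i))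
        ≡⟨ ≡.cong (λ t → at ζ (2 * t) -K at ζ (suc (2 * t))) (≡.sym (toℕ-cast i)) ⟩
      at ζ (2 * toℕ k) -K at ζ (suc (2 * toℕ k))
        ≈⟨ +-cong (ζ≈pqCoord _ (2k<n k)) (-‿cong (ζ≈pqCoord _ (1+2k<n k))) ⟩
      pqCoord p q (2 * toℕ k) -K pqCoord p q (suc (2 * toℕ k))
        ≈⟨ pqCoord-p p q k ⟩
      p k ∎
      where k = ≡.subst Fin n/2≡m i
    q-recovered : ∀ i → eval (pqOfX F n (inj₂ i)) ζ ≈ q (≡.subst Fin n/2≡m i)
    q-recovered i = begin
      eval (xv F n (suc (2 * toℕ i))) ζ -K eval (xv F n (suc (suc (2 * toℕ i)))) ζ
        ≈⟨ +-cong (eval-xv n (suc (2 * toℕ i)) ζ) (-‿cong (eval-xv n (suc (suc (2 * toℕ i))) ζ)) ⟩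
      at ζ (suc (2 * toℕ i)) -K at ζ (suc (suc (2 * toℕ i)))
        ≡⟨ ≡.cong (λ t → at ζ (suc (2 * t)) -K at ζ (suc (suc (2 * t)))) (≡.sym (toℕ-cast i)) ⟩
      at ζ (suc (2 * toℕ k)) -K at ζ (suc (suc (2 * toℕ k)))
        ≈⟨ +-cong (ζ≈pqCoord _ (1+2k<n k)) (-‿cong (ζ≈pqCoord _ (2+2k<n k))) ⟩
      pqCoord p q (suc (2 * toℕ k)) -K pqCoord p q (suc (suc (2 * toℕ k)))
        ≈⟨ pqCoord-q p q k ⟩
      q k ∎
      where k = ≡.subst Fin n/2≡m i

  -- The kernel of Φx→pq

  InIdealM₁⇒Φx→pq≐0 : ∀ (f : XPoly F) → InIdealM₁ F f → ∀ m → _≐_ F (Φx→pq F f m) (zeroPQ F m)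
  InIdealM₁⇒Φx→pq≐0 f (g , _ , f≐M₁*g) m ρ = begin
    eval (Φx→pq F f m) ρ             ≈⟨ eval-subst (f n) (xOfPQ F m) ρ ⟩
    eval (f n) ζ                     ≈⟨ f≐M₁*g n ζ ⟩
    eval (M₁ F n) ζ *K eval (g n) ζ  ≈⟨ *-congʳ (trans (eval-M₁ n ζ) (alt-xOfPQ m ρ)) ⟩
    0# *K eval (g n) ζ               ≈⟨ zeroˡ _ ⟩
    0#                               ∎
    where
    n = suc (2 * m)
    ζ = λ j → eval (xOfPQ F m j) ρ

  Φx→pq≐0⇒vanishing-on-odd : ∀ (f : XPoly F) → (∀ m → _≐_ F (Φx→pq F f m) (zeroPQ F m)) →
    ∀ m (ζ : Vector Carrier (suc (2 * m))) → alt ζ ≈ 0# → eval (f (suc (2 * m))) ζ ≈ 0#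
  Φx→pq≐0⇒vanishing-on-odd f Φf≐0 m ζ alt≈0 = begin
    eval (f (suc (2 * m))) ζ
      ≈⟨ eval-cong (f _) (alt≈0⇒xOfPQ-differences m ζ alt≈0) ⟩
    eval (f (suc (2 * m))) (λ j → eval (xOfPQ F m j) (differences ζ))
      ≈⟨ eval-subst (f _) (xOfPQ F m) (differences ζ) ⟨
    eval (Φx→pq F f m) (differences ζ)
      ≈⟨ Φf≐0 m (differences ζ) ⟩
    0# ∎

  Φx→pq≐0⇒vanishing : ∀ (f : XPoly F) → IsStableX F f → (∀ m → _≐_ F (Φx→pq F f m) (zeroPQ F m)) →
    ∀ n (ζ : Vector Carrier n) → alt ζ ≈ 0# → eval (f n) ζ ≈ 0#
  Φx→pq≐0⇒vanishing f stable Φf≐0 n ζ alt≈0 with parity n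
  ... | odd m  = Φx→pq≐0⇒vanishing-on-odd f Φf≐0 m ζ alt≈0
  ... | even m = trans (sym (stable (2 * m) ζ))
                       (Φx→pq≐0⇒vanishing-on-odd f Φf≐0 m (ext0 F ζ) (trans (alt-ext0 ζ) alt≈0))

  shift₀ : ∀ {n} → Fin (suc n) → Poly F (Fin (suc n))
  shift₀ {n} fz     = var fz ⊕ (⊝ M₁ F (suc n))
  shift₀     (fs k) = var (fs k)

  alt-shift₀ : ∀ {n} (ρ : Vector Carrier (suc n)) → alt (λ v → eval (shift₀ v) ρ) ≈ 0#
  alt-shift₀ {n} ρ = begin
    (head ρ -K eval (M₁ F (suc n)) ρ) -K A  ≈⟨ +-congʳ (+-congˡ (-‿cong (eval-M₁ (suc n) ρ))) ⟩
    (head ρ -K (head ρ -K A)) -K A          ≈⟨ solve 2 (λ r A → (r :- (r :- A)) :- A := κ (+ 0)) refl (head ρ) A ⟩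
    0#                                      ∎
    where A = alt (tail ρ)

  -- shift₀ moves x₀ by −M₁, so p − p ∘ shift₀ is divisible by M₁; the quotient follows the
  -- product rule for divided differences.
  divDiff₀ : ∀ {n} → Poly F (Fin (suc n)) → Poly F (Fin (suc n))
  divDiff₀ (con a)      = con 0#
  divDiff₀ (var fz)     = con 1#
  divDiff₀ (var (fs k)) = con 0#
  divDiff₀ (p ⊕ q)      = divDiff₀ p ⊕ divDiff₀ q
  divDiff₀ (p ⊗ q)      = (divDiff₀ p ⊗ q) ⊕ (subst F p shift₀ ⊗ divDiff₀ q)
  divDiff₀ (⊝ p)        = ⊝ divDiff₀ p

  eval-divDiff₀ : ∀ {n} (p : Poly F (Fin (suc n))) (ρ : Vector Carrier (suc n)) →
    eval p ρ -K eval (subst F p shift₀) ρ ≈ alt ρ *K eval (divDiff₀ p) ρ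
  eval-divDiff₀ (con a) ρ = trans (-‿inverseʳ a) (sym (zeroʳ (alt ρ)))
  eval-divDiff₀ {n} (var fz) ρ = begin
    head ρ -K (head ρ -K eval (M₁ F (suc n)) ρ)  ≈⟨ solve 2 (λ r M → r :- (r :- M) := M) refl (head ρ) _ ⟩
    eval (M₁ F (suc n)) ρ                        ≈⟨ eval-M₁ (suc n) ρ ⟩
    alt ρ                                        ≈⟨ *-identityʳ _ ⟨
    alt ρ *K 1#                                  ∎
  eval-divDiff₀ (var (fs k)) ρ = trans (-‿inverseʳ (ρ (fs k))) (sym (zeroʳ (alt ρ)))
  eval-divDiff₀ (p ⊕ q) ρ = begin
    (a +K b) -K (a′ +K b′)
      ≈⟨ solve 4 (λ a b a′ b′ → (a :+ b) :- (a′ :+ b′) := (a :- a′) :+ (b :- b′)) refl a b a′ b′ ⟩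
    (a -K a′) +K (b -K b′)
      ≈⟨ +-cong (eval-divDiff₀ p ρ) (eval-divDiff₀ q ρ) ⟩
    alt ρ *K dp +K alt ρ *K dq
      ≈⟨ distribˡ _ _ _ ⟨
    alt ρ *K (dp +K dq) ∎
    where
    a = eval p ρ; b = eval q ρ; a′ = eval (subst F p shift₀) ρ; b′ = eval (subst F q shift₀) ρ
    dp = eval (divDiff₀ p) ρ; dq = eval (divDiff₀ q) ρ
  eval-divDiff₀ (p ⊗ q) ρ = begin
    a *K b -K a′ *K b′
      ≈⟨ solve 4 (λ a b a′ b′ → a :* b :- a′ :* b′ := (a :- a′) :* b :+ a′ :* (b :- b′)) refl a b a′ b′ ⟩
    (a -K a′) *K b +K a′ *K (b -K b′)
      ≈⟨ +-cong (*-congʳ (eval-divDiff₀ p ρ)) (*-congˡ (eval-divDiff₀ q ρ)) ⟩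
    (M *K dp) *K b +K a′ *K (M *K dq)
      ≈⟨ solve 5 (λ M dp b a′ dq → (M :* dp) :* b :+ a′ :* (M :* dq) := M :* (dp :* b :+ a′ :* dq)) refl M dp b a′ dq ⟩
    M *K (dp *K b +K a′ *K dq) ∎
    where
    a = eval p ρ; b = eval q ρ; a′ = eval (subst F p shift₀) ρ; b′ = eval (subst F q shift₀) ρ
    M = alt ρ; dp = eval (divDiff₀ p) ρ; dq = eval (divDiff₀ q) ρ
  eval-divDiff₀ (⊝ p) ρ = begin
    (-K a) -K (-K a′)                  ≈⟨ solve 2 (λ a a′ → (:- a) :- (:- a′) := :- (a :- a′)) refl a a′ ⟩
    -K (a -K a′)                       ≈⟨ -‿cong (eval-divDiff₀ p ρ) ⟩
    -K (alt ρ *K eval (divDiff₀ p) ρ)  ≈⟨ -‿distribʳ-* _ _ ⟩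
    alt ρ *K (-K eval (divDiff₀ p) ρ)  ∎
    where a = eval p ρ; a′ = eval (subst F p shift₀) ρ

  ext0ˢ : ∀ {n} → Fin (suc n) → Poly F (Fin n)
  ext0ˢ {zero}  fz     = con 0#
  ext0ˢ {suc n} fz     = var fz
  ext0ˢ {suc n} (fs k) = subst F (ext0ˢ k) (var ∘ fs)

  eval-ext0ˢ : ∀ {n} (ρ : Vector Carrier n) (k : Fin (suc n)) → eval (ext0ˢ k) ρ ≈ ext0 F ρ k
  eval-ext0ˢ {zero}  ρ fz     = refl
  eval-ext0ˢ {suc n} ρ fz     = refl
  eval-ext0ˢ {suc n} ρ (fs k) = trans (eval-subst (ext0ˢ k) (var ∘ fs) ρ) (eval-ext0ˢ (tail ρ) k)

  ins2ˢ : ∀ {n} → Fin (suc n) → Carrier → Fin (suc (suc n)) → Poly F (Fin n)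
  ins2ˢ         fz     a fz          = con a
  ins2ˢ         fz     a (fs fz)     = con a
  ins2ˢ         fz     a (fs (fs k)) = var k
  ins2ˢ {suc n} (fs i) a fz          = var fz
  ins2ˢ {suc n} (fs i) a (fs k)      = subst F (ins2ˢ i a k) (var ∘ fs)

  eval-ins2ˢ : ∀ {n} (i : Fin (suc n)) a (ρ : Vector Carrier n) (k : Fin (suc (suc n))) →
    eval (ins2ˢ i a k) ρ ≈ ins2 F i a ρ k
  eval-ins2ˢ         fz     a ρ fz          = refl
  eval-ins2ˢ         fz     a ρ (fs fz)     = refl
  eval-ins2ˢ         fz     a ρ (fs (fs k)) = refl
  eval-ins2ˢ {suc n} (fs i) a ρ fz          = refl
  eval-ins2ˢ {suc n} (fs i) a ρ (fs k)      =
    trans (eval-subst (ins2ˢ i a k) (var ∘ fs) ρ) (eval-ins2ˢ i a (tail ρ) k)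

  module Quotient (f : XPoly F) (f∈Sol : Sol F f) (Φf≐0 : ∀ m → _≐_ F (Φx→pq F f m) (zeroPQ F m)) where

    f-vanishing : ∀ n (ζ : Vector Carrier n) → alt ζ ≈ 0# → eval (f n) ζ ≈ 0#
    f-vanishing = Φx→pq≐0⇒vanishing f (proj₁ f∈Sol) Φf≐0

    quotient : XPoly F
    quotient zero    = subst F (divDiff₀ (f 1)) (λ _ → con 0#)
    quotient (suc n) = divDiff₀ (f (suc n))

    f≈alt*quotient : ∀ n (ρ : Vector Carrier (suc n)) → eval (f (suc n)) ρ ≈ alt ρ *K eval (quotient (suc n)) ρ
    f≈alt*quotient n ρ = begin
      eval (f (suc n)) ρ
        ≈⟨ solve 2 (λ x y → x := (x :- y) :+ y) refl (eval (f (suc n)) ρ) (eval f∘shift₀ ρ) ⟩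
      (eval (f (suc n)) ρ -K eval f∘shift₀ ρ) +K eval f∘shift₀ ρ
        ≈⟨ +-cong (eval-divDiff₀ (f (suc n)) ρ) f∘shift₀≈0 ⟩
      alt ρ *K eval (quotient (suc n)) ρ +K 0#
        ≈⟨ +-identityʳ _ ⟩
      alt ρ *K eval (quotient (suc n)) ρ ∎
      where
      f∘shift₀ = subst F (f (suc n)) shift₀
      f∘shift₀≈0 : eval f∘shift₀ ρ ≈ 0#
      f∘shift₀≈0 = trans (eval-subst (f (suc n)) shift₀ ρ) (f-vanishing _ _ (alt-shift₀ ρ))

    f≐M₁*quotient : ∀ n → _≐_ F (f n) (M₁ F n ⊗ quotient n)
    f≐M₁*quotient zero    ρ = trans (f-vanishing 0 ρ refl) (sym (zeroˡ _))
    f≐M₁*quotient (suc n) ρ = trans (f≈alt*quotient n ρ) (*-congʳ (sym (eval-M₁ (suc n) ρ)))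

    quotient-invariant : ∀ {n k} (τ : Fin (suc k) → Poly F (Fin (suc n)))
      (T : Vector Carrier (suc n) → Vector Carrier (suc k)) →
      (∀ ρ v → eval (τ v) ρ ≈ T ρ v) → (∀ ρ → alt (T ρ) ≈ alt ρ) →
      (∀ ρ → eval (f (suc k)) (T ρ) ≈ eval (f (suc n)) ρ) →
      ∀ ρ → eval (quotient (suc k)) (T ρ) ≈ eval (quotient (suc n)) ρ
    quotient-invariant {n} {k} τ T τ≈T alt∘T≈alt f∘T≈f ρ = trans (sym (eval-subst∘τ ρ))
      (alt-*-cancelˡ (subst F (quotient (suc k)) τ) (quotient (suc n)) alt*q∘τ≈alt*q ρ)
      where
      eval-subst∘τ : ∀ ρ → eval (subst F (quotient (suc k)) τ) ρ ≈ eval (quotient (suc k)) (T ρ)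
      eval-subst∘τ ρ = trans (eval-subst (quotient (suc k)) τ ρ) (eval-cong (quotient (suc k)) (τ≈T ρ))
      alt*q∘τ≈alt*q : ∀ ρ → alt ρ *K eval (subst F (quotient (suc k)) τ) ρ ≈ alt ρ *K eval (quotient (suc n)) ρ
      alt*q∘τ≈alt*q ρ = begin
        alt ρ *K eval (subst F (quotient (suc k)) τ) ρ  ≈⟨ *-cong (sym (alt∘T≈alt ρ)) (eval-subst∘τ ρ) ⟩
        alt (T ρ) *K eval (quotient (suc k)) (T ρ)     ≈⟨ f≈alt*quotient k (T ρ) ⟨
        eval (f (suc k)) (T ρ)                         ≈⟨ f∘T≈f ρ ⟩
        eval (f (suc n)) ρ                             ≈⟨ f≈alt*quotient n ρ ⟩
        alt ρ *K eval (quotient (suc n)) ρ             ∎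

    quotient-stable : IsStableX F quotient
    quotient-stable zero    ρ =
      sym (trans (eval-subst (divDiff₀ (f 1)) (λ _ → con 0#) ρ) (eval-cong (divDiff₀ (f 1)) λ { fz → refl }))
    quotient-stable (suc n) = quotient-invariant ext0ˢ (ext0 F) eval-ext0ˢ alt-ext0 (proj₁ f∈Sol (suc n))

    quotient-ins2-suc : ∀ n (i : Fin (suc (suc n))) a (ρ : Vector Carrier (suc n)) →
      eval (quotient (suc (suc (suc n)))) (ins2 F i a ρ) ≈ eval (quotient (suc n)) ρ
    quotient-ins2-suc n i a =
      quotient-invariant (ins2ˢ i a) (ins2 F i a) (eval-ins2ˢ i a) (alt-ins2 i a) (proj₂ f∈Sol (suc n) i a)

    -- For n = 0 both sides are constants: compare (a, a) with (0, 0) through (a, a, 0, 0).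
    quotient-ins2 : ∀ n (i : Fin (suc n)) a (ρ : Vector Carrier n) →
      eval (quotient (suc (suc n))) (ins2 F i a ρ) ≈ eval (quotient n) ρ
    quotient-ins2 (suc n) i  a ρ = quotient-ins2-suc n i a ρ
    quotient-ins2 zero    fz a ρ = begin
      eval (quotient 2) (ins2 F fz a ρ)              ≈⟨ eval-cong (quotient 2) (λ { fz → refl ; (fs fz) → refl }) ⟩
      eval (quotient 2) aa                           ≈⟨ quotient-ins2-suc 1 (fs (fs fz)) 0# aa ⟨
      eval (quotient 4) (ins2 F (fs (fs fz)) 0# aa)  ≈⟨ eval-cong (quotient 4) aa00≈ins2-zz ⟩
      eval (quotient 4) (ins2 F fz a zz)             ≈⟨ quotient-ins2-suc 1 fz a zz ⟩
      eval (quotient 2) zz                           ≈⟨ eval-cong (quotient 2) (λ { fz → refl ; (fs fz) → refl }) ⟩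
      eval (quotient 2) (ext0 F (0# ∷ᵛ []ᵛ))         ≈⟨ quotient-stable 1 (0# ∷ᵛ []ᵛ) ⟩
      eval (quotient 1) (0# ∷ᵛ []ᵛ)                  ≈⟨ quotient-stable 0 ρ ⟩
      eval (quotient 0) ρ                            ∎
      where
      aa zz : Vector Carrier 2
      aa = a ∷ᵛ a ∷ᵛ []ᵛ
      zz = 0# ∷ᵛ 0# ∷ᵛ []ᵛ
      aa00≈ins2-zz : ∀ v → ins2 F (fs (fs fz)) 0# aa v ≈ ins2 F fz a zz v
      aa00≈ins2-zz fz                = refl
      aa00≈ins2-zz (fs fz)           = refl
      aa00≈ins2-zz (fs (fs fz))      = refl
      aa00≈ins2-zz (fs (fs (fs fz))) = refl

    quotient∈Sol : Sol F quotient
    quotient∈Sol = quotient-stable , quotient-ins2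

  Φx→pq≐0⇒InIdealM₁ : ∀ (f : XPoly F) → Sol F f → (∀ m → _≐_ F (Φx→pq F f m) (zeroPQ F m)) →
    InIdealM₁ F f
  Φx→pq≐0⇒InIdealM₁ f f∈Sol Φf≐0 = quotient , quotient∈Sol , f≐M₁*quotient
    where open Quotient f f∈Sol Φf≐0

lemma4p4 : ∀ {c ℓ : Level} (F : CharZeroField c ℓ) →
    (∀ (h : PQPoly F) → Sol′ F h → ∀ m → _≐_ F (Φx→pq F (Φpq→x F h) m) (h m))
    × (∀ (f : XPoly F) → Sol F f →
        ((∀ m → _≐_ F (Φx→pq F f m) (zeroPQ F m)) ⇔ InIdealM₁ F f))
lemma4p4 F =
  (λ h _ → Φx→pq∘Φpq→x≐id F h) ,
  (λ f f∈Sol → mk⇔ (Φx→pq≐0⇒InIdealM₁ F f f∈Sol) (InIdealM₁⇒Φx→pq≐0 F f))
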